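{- There exists a deterministic two-party communication protocol that, given an $n$-vertex graph $G$ (Alice holding edge set $E_A$, Bob holding a disjoint edge set $E_B$ on a common vertex set $V$ known to both, $G=(V,E_A\cup E_B)$) and an integer $k$ known to both, decides whether the degeneracy $\kappa(G)\le k$ using $O(n\log^2 n)$ bits of communication. Moreover, if the protocol accepts, it outputs a $k$-ordering of the vertices of $G$, and if it rejects, it outputs a $(k+1)$-core in $G$.
   Context: For an undirected graph $G=(V,E)$ and integer $k\ge1$, a $k$-core is a maximal set $S\subseteq V$ such that $G[S]$ has minimum degree at least $k$; the degeneracy $\kappa(G)$ is the largest $k\ge0$ such that $G$ contains a non-empty $k$-core. For an ordering $\sigma$ of $V$, $\mathrm{odeg}_\sigma(v)$ is the number of neighbors of $v$ appearing after $v$ in $\sigma$; $\sigma$ is a $k$-ordering if $\mathrm{odeg}_\sigma(v)\le k$ for all $v\in V$. -}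

module Defs where

open import Data.Bool using (Bool; true; false; if_then_else_; _∨_)
open import Data.Nat using (ℕ; zero; suc; _+_; _*_; _^_; _≤_; _<_)
open import Data.Nat.Logarithm using (⌈log₂_⌉)
open import Data.Fin using (Fin) renaming (_<_ to _<ᶠ_)
open import Data.Fin.Subset using (Subset; _∈_; _⊆_; _∩_; ∣_∣; Nonempty)
open import Data.Fin.Permutation using (Permutation′; _⟨$⟩ʳ_)
open import Data.Fin.Properties using (_<?_)
open import Data.Vec using (tabulate)
open import Data.Product using (_×_; Σ; ∃; _,_)
open import Data.Sum using (_⊎_; inj₁; inj₂)
open import Relation.Nullary using (¬_)
open import Relation.Nullary.Decidable using (⌊_⌋)
open import Relation.Binary.PropositionalEquality using (_≡_)

record Graph (n : ℕ) : Set where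
  field
    adj   : Fin n → Fin n → Bool
    sym   : ∀ u v → adj u v ≡ adj v u
    irrefl : ∀ v → adj v v ≡ false
open Graph public

_∪ᴳ_ : ∀ {n} → Graph n → Graph n → Graph n
Graph.adj (G ∪ᴳ H) u v = adj G u v ∨ adj H u v
Graph.sym (G ∪ᴳ H) u v rewrite sym G u v | sym H u v = Relation.Binary.PropositionalEquality.refl
Graph.irrefl (G ∪ᴳ H) v rewrite irrefl G v | irrefl H v = Relation.Binary.PropositionalEquality.refl

Disjoint : ∀ {n} → Graph n → Graph n → Set
Disjoint G H = ∀ u v → adj G u v ≡ true → adj H u v ≡ false

N : ∀ {n} → Graph n → Fin n → Subset n
N G v = tabulate (adj G v)

degIn : ∀ {n} → Graph n → Subset n → Fin n → ℕ
degIn G S v = ∣ N G v ∩ S ∣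

MinDegAtLeast : ∀ {n} → Graph n → ℕ → Subset n → Set
MinDegAtLeast G k S = ∀ v → v ∈ S → k ≤ degIn G S v

IsCore : ∀ {n} → Graph n → ℕ → Subset n → Set
IsCore G k S = MinDegAtLeast G k S × (∀ T → S ⊆ T → MinDegAtLeast G k T → T ≡ S)

HasNonemptyCore : ∀ {n} → Graph n → ℕ → Set
HasNonemptyCore G k = ∃ λ S → IsCore G k S × Nonempty S

-- d is the degeneracy κ(G): the largest k ≥ 0 such that G has a non-empty
-- k-core (k-cores are only defined for k ≥ 1; κ = 0 if there is none).
IsDegeneracy : ∀ {n} → Graph n → ℕ → Set
IsDegeneracy G d =
  (d ≡ 0 ⊎ (1 ≤ d × HasNonemptyCore G d)) × (∀ j → 1 ≤ j → d < j → ¬ HasNonemptyCore G j)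

-- Orderings: σ ⟨$⟩ʳ v is the position of v in the ordering.
Ordering : ℕ → Set
Ordering n = Permutation′ n

odeg : ∀ {n} → Graph n → Ordering n → Fin n → ℕ
odeg G σ v = ∣ N G v ∩ tabulate (λ u → ⌊ (σ ⟨$⟩ʳ v) <? (σ ⟨$⟩ʳ u) ⌋) ∣

IsKOrdering : ∀ {n} → Graph n → ℕ → Ordering n → Set
IsKOrdering G k σ = ∀ v → odeg G σ v ≤ k

data Protocol (X Y O : Set) : Set where
  leaf  : O → Protocol X Y O
  alice : (X → Bool) → Protocol X Y O → Protocol X Y O → Protocol X Y O
  bob   : (Y → Bool) → Protocol X Y O → Protocol X Y O → Protocol X Y O

module _ {X Y O : Set} where
  run : Protocol X Y O → X → Y → O
  run (leaf o) x y = o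
  run (alice f p q) x y = if f x then run p x y else run q x y
  run (bob g p q) x y = if g y then run p x y else run q x y

  bits : Protocol X Y O → X → Y → ℕ
  bits (leaf o) x y = 0
  bits (alice f p q) x y = suc (if f x then bits p x y else bits q x y)
  bits (bob g p q) x y = suc (if g y then bits p x y else bits q x y)

Out : ℕ → Set
Out n = Ordering n ⊎ Subset n

Correct : ∀ {n} → Graph n → ℕ → Out n → Set
Correct G k (inj₁ σ) = (∀ d → IsDegeneracy G d → d ≤ k) × IsKOrdering G k σ
Correct G k (inj₂ S) = (∀ d → IsDegeneracy G d → k < d) × IsCore G (suc k) S × Nonempty S

-- The protocol simulates peeling: repeatedly delete from the remaining set R a
-- vertex of degree at most k in G[R].  The deletion order is a k-ordering, and a
-- set on which peeling gets stuck is the (k+1)-core.  Degrees in G[R] are split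
-- between the players, so both keep public upper bounds boundᴬ(u), boundᴮ(u) on
-- the degree of u into R along E_A and E_B, and u is deleted once their sum is at
-- most k.  Otherwise a player announces some u with its exact degree provided
-- this at least halves the excess boundᴬ(u) + boundᴮ(u) − k; if neither player
-- can, adding the two failed halving conditions shows that every vertex of R has
-- degree > k in G[R].  The excess starts below 2^(⌈log₂ n⌉+2), so each vertex is
-- announced O(log n) times, at O(log n) bits per announcement.
module Submission where

open import Defs hiding (sym)
open import Data.Bool using (Bool; true; false; if_then_else_; _∨_)
open import Data.Bool.Properties using (if-float)
open import Data.Fin using (Fin; toℕ; fromℕ<; _≟_) renaming (zero to fzero; suc to fsuc)
open import Data.Fin.Properties using (any?; nonZeroIndex; toℕ<n; toℕ-injective; toℕ-fromℕ<; fromℕ<-toℕ)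
  renaming (_<?_ to _<ᶠ?_)
open import Data.Fin.Permutation using (_⟨$⟩ʳ_; _∘ₚ_; transpose; id)
import Data.Fin.Permutation.Components as PC
open import Data.Fin.Subset using (Subset; _∈_; _∉_; _⊆_; _∩_; _∪_; _─_; _-_; ⁅_⁆; ∣_∣; ⊤; Nonempty; Empty)
open import Data.Fin.Subset.Properties
  using (_∈?_; nonempty?; ∣p∣≤n; p⊆q⇒∣p∣≤∣q∣; x∈p∩q⁺; x∈p∩q⁻; ∩-distribʳ-∪; Empty-unique; ∣⊥∣≡0;
         ⊆-antisym; ⊆-trans; ∈⊤; ⊆⊤; x∈⁅x⁆; p─q⊆p; x∈p∧x≢y⇒x∈p-y; x∈p⇒∣p-x∣<∣p∣)
open import Data.Maybe using (Maybe; just; nothing; is-just; maybe′)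
open import Data.Nat
  using (ℕ; zero; suc; pred; _+_; _*_; _∸_; _^_; _≤_; _<_; z≤n; s≤s; s≤s⁻¹; _≤?_; _<?_;
         ⌊_/2⌋; ⌈_/2⌉; >-nonZero)
open import Data.Nat.DivMod using (_mod_; m<n⇒m%n≡m)
open import Data.Nat.Induction using (<-wellFounded)
open import Data.Nat.Logarithm using (⌈log₂_⌉; ⌈log₂⌉-mono-≤; ⌈log₂2^n⌉≡n)
open import Data.Nat.Logarithm.Core using (⌈log2⌉)
open import Data.Nat.Properties
  using (≤-refl; ≤-reflexive; ≤-trans; <-trans; <-≤-trans; ≤-<-trans; <-irrefl; n≮n; <⇒≱; ≮⇒≥; ≰⇒>;
         ≤∧≢⇒<; m<n⇒m<1+n; n<1+n; m<1+n⇒m≤n; n<1⇒n≡0; m≤m+n; m≤n+m; m<m+n;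
         +-comm; +-assoc; +-suc; +-identityʳ; +-mono-≤; +-monoˡ-≤; +-monoʳ-≤; +-mono-<; +-monoˡ-<; +-monoʳ-<;
         +-cancelʳ-<; *-monoʳ-≤; *-cancelˡ-<; *-distribˡ-+; m^n≢0; m^n>0; suc-pred;
         m+[n∸m]≡n; m<n+o⇒m∸n<o; ⌊n/2⌋+⌈n/2⌉≡n; ⌊n/2⌋≤⌈n/2⌉; ⌈n/2⌉<n; module ≤-Reasoning)
open import Data.Nat.Tactic.RingSolver using (solve-∀)
open import Data.Product using (Σ; ∃; _×_; _,_; proj₁; proj₂)
open import Data.Sum using (inj₁; inj₂)
open import Data.Vec
  using (Vec; []; _∷_; here; there; lookup; tabulate; zipWith; updateAt; replicate; map; sum)
open import Data.Vec.Properties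
  using (lookup∘tabulate; []=⇒lookup; lookup⇒[]=; lookup∘updateAt; lookup∘updateAt′;
         lookup-replicate; map-replicate)
open import Function using (_∘_)
open import Function.Bundles using (Injection)
open import Function.Properties.Inverse using (↔⇒↣)
open import Induction.WellFounded using (Acc; acc)
open import Relation.Nullary using (¬_; Dec; yes; no; does; contradiction; _×-dec_)
open import Relation.Nullary.Decidable using (⌊_⌋; isYes≗does; dec-true; dec-false)
open import Relation.Binary.PropositionalEquality

private variable
  n k : ℕ

x∈p─q⇒x∉q : ∀ {x : Fin n} (p q : Subset n) → x ∈ p ─ q → x ∉ q
x∈p─q⇒x∉q (true ∷ p) (false ∷ q) here ()
x∈p─q⇒x∉q (_ ∷ p)    (_ ∷ q)     (there x∈p─q) (there x∈q) = x∈p─q⇒x∉q p q x∈p─q x∈q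

x∉p-x : ∀ (p : Subset n) x → x ∉ p - x
x∉p-x p x x∈p-x = x∈p─q⇒x∉q p ⁅ x ⁆ x∈p-x (x∈⁅x⁆ x)

∣p∪q∣+∣p∩q∣≡∣p∣+∣q∣ : ∀ (p q : Subset n) → ∣ p ∪ q ∣ + ∣ p ∩ q ∣ ≡ ∣ p ∣ + ∣ q ∣
∣p∪q∣+∣p∩q∣≡∣p∣+∣q∣ []          []          = refl
∣p∪q∣+∣p∩q∣≡∣p∣+∣q∣ (true  ∷ p) (true  ∷ q) =
  cong suc (trans (+-suc _ _) (trans (cong suc (∣p∪q∣+∣p∩q∣≡∣p∣+∣q∣ p q)) (sym (+-suc _ _))))
∣p∪q∣+∣p∩q∣≡∣p∣+∣q∣ (true  ∷ p) (false ∷ q) = cong suc (∣p∪q∣+∣p∩q∣≡∣p∣+∣q∣ p q)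
∣p∪q∣+∣p∩q∣≡∣p∣+∣q∣ (false ∷ p) (true  ∷ q) = trans (cong suc (∣p∪q∣+∣p∩q∣≡∣p∣+∣q∣ p q)) (sym (+-suc _ _))
∣p∪q∣+∣p∩q∣≡∣p∣+∣q∣ (false ∷ p) (false ∷ q) = ∣p∪q∣+∣p∩q∣≡∣p∣+∣q∣ p q

∩-monoʳ-⊆ : ∀ {p q r : Subset n} → q ⊆ r → p ∩ q ⊆ p ∩ r
∩-monoʳ-⊆ {p = p} {q} q⊆r x∈p∩q with x∈p∩q⁻ p q x∈p∩q
... | x∈p , x∈q = x∈p∩q⁺ (x∈p , q⊆r x∈q)

∈-tabulate⁻ : ∀ {f : Fin n → Bool} {x} → x ∈ tabulate f → f x ≡ true
∈-tabulate⁻ {f = f} {x} x∈ = trans (sym (lookup∘tabulate f x)) ([]=⇒lookup x∈)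

∈-tabulate⁺ : ∀ {f : Fin n → Bool} {x} → f x ≡ true → x ∈ tabulate f
∈-tabulate⁺ {f = f} {x} fx≡true = lookup⇒[]= x (tabulate f) (trans (lookup∘tabulate f x) fx≡true)

zipWith-tabulate : ∀ {A B C : Set} (f : A → B → C) (g : Fin n → A) (h : Fin n → B) →
                   zipWith f (tabulate g) (tabulate h) ≡ tabulate (λ i → f (g i) (h i))
zipWith-tabulate {zero}  f g h = refl
zipWith-tabulate {suc n} f g h = cong (_ ∷_) (zipWith-tabulate f (g ∘ fsuc) (h ∘ fsuc))

sum-map-updateAt-< : ∀ {A : Set} (g : A → ℕ) (xs : Vec A n) i {f : A → A} →
                     g (f (lookup xs i)) < g (lookup xs i) → sum (map g (updateAt xs i f)) < sum (map g xs)
sum-map-updateAt-< g (x ∷ xs) fzero    lt = +-monoˡ-< _ lt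
sum-map-updateAt-< g (x ∷ xs) (fsuc i) lt = +-monoʳ-< (g x) (sum-map-updateAt-< g xs i lt)

sum-replicate : ∀ n x → sum (replicate n x) ≡ n * x
sum-replicate zero    x = refl
sum-replicate (suc n) x = cong (x +_) (sum-replicate n x)

degIn≤n : ∀ (G : Graph n) S v → degIn G S v ≤ n
degIn≤n G S v = ∣p∣≤n (N G v ∩ S)

degIn-mono : ∀ (G : Graph n) {S T} v → S ⊆ T → degIn G S v ≤ degIn G T v
degIn-mono G v S⊆T = p⊆q⇒∣p∣≤∣q∣ (∩-monoʳ-⊆ {p = N G v} S⊆T)

N-∪ᴳ : ∀ (G H : Graph n) v → N (G ∪ᴳ H) v ≡ N G v ∪ N H v
N-∪ᴳ G H v = sym (zipWith-tabulate _∨_ (adj G v) (adj H v))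

degIn-∪ᴳ : ∀ {G H : Graph n} → Disjoint G H → ∀ S v → degIn (G ∪ᴳ H) S v ≡ degIn G S v + degIn H S v
degIn-∪ᴳ {n} {G} {H} disjoint S v = begin
  ∣ N (G ∪ᴳ H) v ∩ S ∣         ≡⟨ cong (λ p → ∣ p ∩ S ∣) (N-∪ᴳ G H v) ⟩
  ∣ (N G v ∪ N H v) ∩ S ∣      ≡⟨ cong ∣_∣ (∩-distribʳ-∪ S (N G v) (N H v)) ⟩
  ∣ NG ∪ NH ∣                  ≡⟨ sym (+-identityʳ _) ⟩
  ∣ NG ∪ NH ∣ + 0              ≡⟨ cong (∣ NG ∪ NH ∣ +_) (sym ∣NG∩NH∣≡0) ⟩
  ∣ NG ∪ NH ∣ + ∣ NG ∩ NH ∣    ≡⟨ ∣p∪q∣+∣p∩q∣≡∣p∣+∣q∣ NG NH ⟩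
  ∣ NG ∣ + ∣ NH ∣              ∎
  where
  open ≡-Reasoning
  NG NH : Subset n
  NG = N G v ∩ S
  NH = N H v ∩ S
  adjacent : ∀ E {x} → x ∈ N E v ∩ S → adj E v x ≡ true
  adjacent E x∈ = ∈-tabulate⁻ (proj₁ (x∈p∩q⁻ (N E v) S x∈))
  no-common : Empty (NG ∩ NH)
  no-common (x , x∈) with x∈p∩q⁻ NG NH x∈
  ... | x∈NG , x∈NH with trans (sym (adjacent H x∈NH)) (disjoint v x (adjacent G x∈NG))
  ...   | ()
  ∣NG∩NH∣≡0 : ∣ NG ∩ NH ∣ ≡ 0
  ∣NG∩NH∣≡0 = trans (cong ∣_∣ (Empty-unique no-common)) (∣⊥∣≡0 n)

ContainsDense : Graph n → ℕ → Subset n → Set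
ContainsDense G k R = ∀ T → MinDegAtLeast G k T → T ⊆ R

containsDense-remove : ∀ (G : Graph n) {R v} → ContainsDense G (suc k) R → degIn G R v ≤ k →
                       ContainsDense G (suc k) (R - v)
containsDense-remove {k = k} G {R} {v} dense⊆R deg≤k T dense {u} u∈T with u ≟ v
... | no  u≢v  = x∈p∧x≢y⇒x∈p-y (dense⊆R T dense u∈T) u≢v
... | yes refl =
  contradiction (≤-trans (dense u u∈T) (≤-trans (degIn-mono G u (dense⊆R T dense)) deg≤k)) (n≮n k)

isCore-if-containsDense : ∀ (G : Graph n) {S} → MinDegAtLeast G k S → ContainsDense G k S → IsCore G k S
isCore-if-containsDense G dense dense⊆S = dense , λ T S⊆T denseT → ⊆-antisym (dense⊆S T denseT) S⊆T

degeneracy≤-if-empty : ∀ (G : Graph n) {R} → ContainsDense G (suc k) R → Empty R →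
                       ∀ d → IsDegeneracy G d → d ≤ k
degeneracy≤-if-empty G dense⊆R R-empty d (inj₁ refl , _) = z≤n
degeneracy≤-if-empty G dense⊆R R-empty d (inj₂ (_ , S , (dense , _) , x , x∈S) , _) =
  ≮⇒≥ λ k<d → R-empty (x , dense⊆R S (λ u u∈S → ≤-trans k<d (dense u u∈S)) x∈S)

degeneracy>-if-core : ∀ (G : Graph n) {S} → IsCore G (suc k) S → Nonempty S →
                      ∀ d → IsDegeneracy G d → k < d
degeneracy>-if-core G core nonempty d (_ , no-denser) =
  ≰⇒> λ d≤k → no-denser _ (s≤s z≤n) (s≤s d≤k) (_ , core , nonempty)

transpose-closed : ∀ {P : Fin n → Set} {i j} → P i → P j → ∀ {x} → P x → P (PC.transpose i j x)
transpose-closed {i = i} {j} Pi Pj {x} Px with x ≟ i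
... | yes _ = Pj
... | no  _ with x ≟ j
...   | yes _ = Pi
...   | no  _ = Px

transpose-fixes : ∀ {i j x : Fin n} → x ≢ i → x ≢ j → PC.transpose i j x ≡ x
transpose-fixes {i = i} {j} {x} x≢i x≢j with x ≟ i
... | yes x≡i = contradiction x≡i x≢i
... | no  _ with x ≟ j
...   | yes x≡j = contradiction x≡j x≢j
...   | no  _   = refl

transpose-hits : ∀ (i j : Fin n) → PC.transpose i j i ≡ j
transpose-hits i j with i ≟ i
... | yes _   = refl
... | no  i≢i = contradiction refl i≢i

transpose-misses : ∀ {i j x : Fin n} → x ≢ i → PC.transpose i j x ≢ j
transpose-misses {i = i} {j} {x} x≢i τx≡j = x≢i (begin
  x                                     ≡⟨ sym (PC.transpose-inverse j i) ⟩
  PC.transpose j i (PC.transpose i j x) ≡⟨ cong (PC.transpose j i) τx≡j ⟩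
  PC.transpose j i j                    ≡⟨ transpose-hits j i ⟩
  i                                     ∎)
  where open ≡-Reasoning

-- odeg G σ v is degIn G (later σ v) v by definition.
later : Ordering n → Fin n → Subset n
later σ v = tabulate (λ u → ⌊ σ ⟨$⟩ʳ v <ᶠ? σ ⟨$⟩ʳ u ⌋)

∈later⁺ : ∀ {σ : Ordering n} {u v} → toℕ (σ ⟨$⟩ʳ v) < toℕ (σ ⟨$⟩ʳ u) → u ∈ later σ v
∈later⁺ {σ = σ} {u} {v} lt =
  ∈-tabulate⁺ (trans (isYes≗does (σ ⟨$⟩ʳ v <ᶠ? σ ⟨$⟩ʳ u)) (dec-true (σ ⟨$⟩ʳ v <ᶠ? σ ⟨$⟩ʳ u) lt))

∈later⁻ : ∀ {σ : Ordering n} {u v} → u ∈ later σ v → toℕ (σ ⟨$⟩ʳ v) < toℕ (σ ⟨$⟩ʳ u)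
∈later⁻ {σ = σ} {u} {v} u∈ with σ ⟨$⟩ʳ v <ᶠ? σ ⟨$⟩ʳ u | ∈-tabulate⁻ u∈
... | yes lt | _ = lt

record PeelingOrder (G : Graph n) (k : ℕ) (R : Subset n) (σ : Ordering n) (t : ℕ) : Set where
  field
    alive-late   : ∀ {u} → u ∈ R → t ≤ toℕ (σ ⟨$⟩ʳ u)
    peeled-early : ∀ {u} → u ∉ R → toℕ (σ ⟨$⟩ʳ u) < t
    peeled-odeg  : ∀ {u} → u ∉ R → odeg G σ u ≤ k

module _ {G : Graph n} {R σ t} (ord : PeelingOrder G k R σ t) {v} (v∈R : v ∈ R)
         (slot : Fin n) (slot≡t : toℕ slot ≡ t) where
  open PeelingOrder ord

  private
    pos : Fin n → Fin n
    pos = σ ⟨$⟩ʳ_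

    σ′ : Ordering n
    σ′ = σ ∘ₚ transpose (pos v) slot

    τ : Fin n → Fin n
    τ = PC.transpose (pos v) slot

    pos-injective : ∀ {u w} → pos u ≡ pos w → u ≡ w
    pos-injective = Injection.injective (↔⇒↣ σ)

    v-at-t : toℕ (σ′ ⟨$⟩ʳ v) ≡ t
    v-at-t = trans (cong toℕ (transpose-hits (pos v) slot)) slot≡t

    early⇒fixed : ∀ {a} → toℕ a < t → τ a ≡ a
    early⇒fixed a<t = transpose-fixes
      (λ a≡pv → contradiction (alive-late v∈R) (<⇒≱ (subst (λ b → toℕ b < t) a≡pv a<t)))
      (λ a≡slot → <-irrefl (trans (cong toℕ a≡slot) slot≡t) a<t)

    alive-late′ : ∀ {u} → u ∈ R - v → suc t ≤ toℕ (σ′ ⟨$⟩ʳ u)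
    alive-late′ {u} u∈R′ =
      ≤∧≢⇒< late (λ t≡ → transpose-misses pu≢pv (toℕ-injective (trans (sym t≡) (sym slot≡t))))
      where
      late : t ≤ toℕ (τ (pos u))
      late = transpose-closed {P = λ a → t ≤ toℕ a}
        (alive-late v∈R) (≤-reflexive (sym slot≡t)) (alive-late (p─q⊆p R _ u∈R′))
      pu≢pv : pos u ≢ pos v
      pu≢pv pu≡pv = x∉p-x R v (subst (_∈ R - v) (pos-injective pu≡pv) u∈R′)

    peeled-early′ : ∀ {u} → u ∉ R - v → toℕ (σ′ ⟨$⟩ʳ u) < suc t
    peeled-early′ {u} u∉R′ with u ≟ v
    ... | yes refl = ≤-reflexive (cong suc v-at-t)
    ... | no  u≢v  = m<n⇒m<1+n (subst (λ a → toℕ a < t) (sym (early⇒fixed early)) early)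
      where
      early : toℕ (pos u) < t
      early = peeled-early (λ u∈R → u∉R′ (x∈p∧x≢y⇒x∈p-y u∈R u≢v))

    later-v⊆R′ : later σ′ v ⊆ R - v
    later-v⊆R′ {x} x∈later with x ∈? R - v
    ... | yes x∈R′ = x∈R′
    ... | no  x∉R′ = contradiction (s≤s⁻¹ (peeled-early′ x∉R′))
                       (<⇒≱ (subst (_< toℕ (σ′ ⟨$⟩ʳ x)) v-at-t (∈later⁻ {σ = σ′} x∈later)))

    -- Both transposed positions lie after u, so whether x comes after u is unchanged.
    later′⊆later : ∀ {u} → u ∉ R → later σ′ u ⊆ later σ u
    later′⊆later {u} u∉R {x} x∈later = ∈later⁺ {σ = σ}
      (subst (λ a → toℕ (pos u) < toℕ a) (PC.transpose-inverse slot (pos v))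
        (transpose-closed {P = λ a → toℕ (pos u) < toℕ a}
          (<-≤-trans early (≤-reflexive (sym slot≡t))) (<-≤-trans early (alive-late v∈R))
          (subst (λ a → toℕ a < toℕ (τ (pos x))) (early⇒fixed early) (∈later⁻ {σ = σ′} x∈later))))
      where
      early : toℕ (pos u) < t
      early = peeled-early u∉R

  peelingOrder-remove : degIn G R v ≤ k → PeelingOrder G k (R - v) σ′ (suc t)
  peelingOrder-remove deg≤k = record
    { alive-late   = alive-late′
    ; peeled-early = peeled-early′
    ; peeled-odeg  = peeled-odeg′ }
    where
    peeled-odeg′ : ∀ {u} → u ∉ R - v → odeg G σ′ u ≤ k
    peeled-odeg′ {u} u∉R′ with u ≟ v
    ... | yes refl = ≤-trans (degIn-mono G v (⊆-trans later-v⊆R′ (p─q⊆p R _))) deg≤k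
    ... | no  u≢v  = ≤-trans (degIn-mono G u (later′⊆later u∉R)) (peeled-odeg u∉R)
      where
      u∉R : u ∉ R
      u∉R u∈R = u∉R′ (x∈p∧x≢y⇒x∈p-y u∈R u≢v)

n≤2*⌈n/2⌉ : ∀ n → n ≤ 2 * ⌈ n /2⌉
n≤2*⌈n/2⌉ n = begin
  n                    ≡⟨ sym (⌊n/2⌋+⌈n/2⌉≡n n) ⟩
  ⌊ n /2⌋ + ⌈ n /2⌉    ≤⟨ +-monoˡ-≤ ⌈ n /2⌉ (⌊n/2⌋≤⌈n/2⌉ n) ⟩
  ⌈ n /2⌉ + ⌈ n /2⌉    ≡⟨ cong (⌈ n /2⌉ +_) (sym (+-identityʳ _)) ⟩
  2 * ⌈ n /2⌉          ∎
  where open ≤-Reasoning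

n≤2^⌈log₂n⌉ : ∀ n → n ≤ 2 ^ ⌈log₂ n ⌉
n≤2^⌈log₂n⌉ n = bound n (<-wellFounded n)
  where
  bound : ∀ n (rec : Acc _<_ n) → n ≤ 2 ^ ⌈log2⌉ n rec
  bound 0             _        = z≤n
  bound 1             _        = s≤s z≤n
  bound (suc (suc n)) (acc rs) = begin
    2 + n                                          ≤⟨ +-monoʳ-≤ 2 (n≤2*⌈n/2⌉ n) ⟩
    2 + 2 * ⌈ n /2⌉                                ≡⟨ sym (*-distribˡ-+ 2 1 ⌈ n /2⌉) ⟩
    2 * suc ⌈ n /2⌉                                ≤⟨ *-monoʳ-≤ 2 (bound (suc ⌈ n /2⌉) (rs (⌈n/2⌉<n n))) ⟩
    2 * 2 ^ ⌈log2⌉ (suc ⌈ n /2⌉) (rs (⌈n/2⌉<n n))  ∎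
    where open ≤-Reasoning

n<2^suc⌈log₂n⌉ : ∀ n → n < 2 ^ suc ⌈log₂ n ⌉
n<2^suc⌈log₂n⌉ n = begin-strict
  n              ≤⟨ n≤2^⌈log₂n⌉ n ⟩
  2 ^ g          <⟨ m<m+n (2 ^ g) (m^n>0 2 g) ⟩
  2 ^ g + 2 ^ g  ≡⟨ cong (2 ^ g +_) (sym (+-identityʳ _)) ⟩
  2 ^ suc g      ∎
  where
  open ≤-Reasoning
  g : ℕ
  g = ⌈log₂ n ⌉

1≤⌈log₂n⌉ : ∀ {n} → 2 ≤ n → 1 ≤ ⌈log₂ n ⌉
1≤⌈log₂n⌉ {n} 2≤n = subst (_≤ ⌈log₂ n ⌉) (⌈log₂2^n⌉≡n 1) (⌈log₂⌉-mono-≤ 2≤n)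

double-below : ∀ {n w} k → n < 2 ^ w → n + n < k + 2 ^ suc w
double-below {n} {w} k n<2^w = begin-strict
  n + n          <⟨ +-mono-< n<2^w n<2^w ⟩
  2 ^ w + 2 ^ w  ≡⟨ cong (2 ^ w +_) (sym (+-identityʳ _)) ⟩
  2 ^ suc w      ≤⟨ m≤n+m _ k ⟩
  k + 2 ^ suc w  ∎
  where open ≤-Reasoning

halve-excess : ∀ {k t t′} b → 2 * t′ ≤ k + t → t < k + 2 ^ suc b → t′ < k + 2 ^ b
halve-excess {k} {t} {t′} b 2t′≤k+t within = *-cancelˡ-< 2 t′ (k + 2 ^ b) (begin-strict
  2 * t′               ≤⟨ 2t′≤k+t ⟩
  k + t                <⟨ +-monoʳ-< k within ⟩
  k + (k + 2 * 2 ^ b)  ≡⟨ regroup k (2 ^ b) ⟩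
  2 * (k + 2 ^ b)      ∎)
  where
  open ≤-Reasoning
  regroup : ∀ k p → k + (k + 2 * p) ≡ 2 * (k + p)
  regroup = solve-∀

excess-split : ∀ {k} a b x y → k + (a + b) < 2 * (x + b) → k + (a + b) < 2 * (a + y) → k < x + y
excess-split {k} a b x y viaA viaB = +-cancelʳ-< (a + b) k (x + y) (*-cancelˡ-< 2 _ _ (begin-strict
  2 * (k + (a + b))              ≡⟨ twice (k + (a + b)) ⟩
  (k + (a + b)) + (k + (a + b))  <⟨ +-mono-< viaA viaB ⟩
  2 * (x + b) + 2 * (a + y)      ≡⟨ regroup x y a b ⟩
  2 * (x + y + (a + b))          ∎))
  where
  open ≤-Reasoning
  twice : ∀ z → 2 * z ≡ z + z
  twice = solve-∀
  regroup : ∀ x y a b → 2 * (x + b) + 2 * (a + y) ≡ 2 * (x + y + (a + b))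
  regroup = solve-∀

claim-cost : ∀ c {Φ′ Φ} m → Φ′ < Φ → c + (suc c * Φ′ + 2) ≤ suc c * Φ + suc m
claim-cost c {Φ′} {Φ} m Φ′<Φ = begin
  c + (suc c * Φ′ + 2)  ≡⟨ regroup c Φ′ ⟩
  suc c * suc Φ′ + 1    ≤⟨ +-mono-≤ (*-monoʳ-≤ (suc c) Φ′<Φ) (s≤s z≤n) ⟩
  suc c * Φ + suc m     ∎
  where
  open ≤-Reasoning
  regroup : ∀ c Φ′ → c + (suc c * Φ′ + 2) ≡ suc c * suc Φ′ + 1
  regroup = solve-∀

-- For g ≥ 1, (g + 2)² ≤ 9g²; this gives 2(g + 2)²n + 2 ≤ 18g²n + 2g²n.
total-cost : ∀ {n g} → 1 ≤ n → 1 ≤ g → suc (suc (suc g + suc g)) * (n * suc (suc g)) + 2 ≤ 20 * n * g ^ 2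
total-cost {suc m} {suc h} _ _ =
  ≤-trans (m≤m+n _ (18 * suc m * h * h + 28 * suc m * h + 2 * m)) (≤-reflexive (expand m h))
  where
  expand : ∀ m h → suc (suc (suc (suc h) + suc (suc h))) * (suc m * suc (suc (suc h))) + 2
                   + (18 * suc m * h * h + 28 * suc m * h + 2 * m)
                   ≡ 20 * suc m * (suc h * (suc h * 1))
  expand = solve-∀

data Party : Set where
  Alice Bob : Party

input : ∀ {I : Set} → Party → I → I → I
input Alice x y = x
input Bob   x y = y

module _ {m : ℕ} where

  vertexCode : Maybe (Fin m × ℕ) → ℕ
  vertexCode = maybe′ (toℕ ∘ proj₁) 0

  numberCode : Maybe (Fin m × ℕ) → ℕ
  numberCode = maybe′ proj₂ 0

  decode : ℕ → ℕ → Maybe (Fin m × ℕ)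
  decode i d with i <? m
  ... | yes i<m = just (fromℕ< i<m , d)
  ... | no  _   = nothing

  decode-toℕ : ∀ u d → decode (toℕ u) d ≡ just (u , d)
  decode-toℕ u d with toℕ u <? m
  ... | yes u<m = cong (λ v → just (v , d)) (fromℕ<-toℕ u u<m)
  ... | no  u≮m = contradiction (toℕ<n u) u≮m

module _ {I O : Set} where

  ask : Party → (I → Bool) → Protocol I I O → Protocol I I O → Protocol I I O
  ask Alice = alice
  ask Bob   = bob

  sendℕ : Party → ℕ → (I → ℕ) → (ℕ → Protocol I I O) → Protocol I I O
  sendℕ p zero    f κ = κ 0
  sendℕ p (suc L) f κ =
    ask p (λ z → does (2 ^ L ≤? f z))
      (sendℕ p L (λ z → f z ∸ 2 ^ L) (κ ∘ (2 ^ L +_)))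
      (sendℕ p L f κ)

  announce : ∀ {m} → Party → ℕ → (I → Maybe (Fin m × ℕ)) → (Maybe (Fin m × ℕ) → Protocol I I O) →
             Protocol I I O
  announce p L h κ =
    ask p (λ z → is-just (h z))
      (sendℕ p L (λ z → vertexCode (h z)) λ i →
       sendℕ p L (λ z → numberCode (h z)) λ d → κ (decode i d))
      (κ nothing)

module Execution {I O : Set} (x y : I) where

  infix 4 _↝⟨_⟩_
  record _↝⟨_⟩_ (π : Protocol I I O) (c : ℕ) (ρ : Protocol I I O) : Set where
    constructor continues
    field
      same-output : run π x y ≡ run ρ x y
      extra-bits  : bits π x y ≡ c + bits ρ x y

  ↝-trans : ∀ {π ρ τ a b} → π ↝⟨ a ⟩ ρ → ρ ↝⟨ b ⟩ τ → π ↝⟨ a + b ⟩ τ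
  ↝-trans {a = a} (continues r₁ b₁) (continues r₂ b₂) =
    continues (trans r₁ r₂) (trans b₁ (trans (cong (a +_) b₂) (sym (+-assoc a _ _))))

  ask-↝ : ∀ p {f π ρ b} → f (input p x y) ≡ b → ask p f π ρ ↝⟨ 1 ⟩ (if b then π else ρ)
  ask-↝ p {f} {π} {ρ} eq = subst (λ b → ask p f π ρ ↝⟨ 1 ⟩ (if b then π else ρ)) eq (ask-if p)
    where
    ask-if : ∀ p → ask p f π ρ ↝⟨ 1 ⟩ (if f (input p x y) then π else ρ)
    ask-if Alice = continues (sym (if-float (λ τ → run τ x y) (f x)))
                             (cong suc (sym (if-float (λ τ → bits τ x y) (f x))))
    ask-if Bob   = continues (sym (if-float (λ τ → run τ x y) (f y)))
                             (cong suc (sym (if-float (λ τ → bits τ x y) (f y))))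

  sendℕ-↝ : ∀ p L f κ → f (input p x y) < 2 ^ L → sendℕ p L f κ ↝⟨ L ⟩ κ (f (input p x y))
  sendℕ-↝ p zero    f κ lt rewrite n<1⇒n≡0 lt = continues refl refl
  sendℕ-↝ p (suc L) f κ lt with 2 ^ L ≤? f (input p x y)
  ... | no  2^L≰ = ↝-trans (ask-↝ p (dec-false (2 ^ L ≤? _) 2^L≰)) (sendℕ-↝ p L f κ (≰⇒> 2^L≰))
  ... | yes 2^L≤ = ↝-trans (ask-↝ p (dec-true (2 ^ L ≤? _) 2^L≤))
        (subst (λ a → sendℕ p L (λ z → f z ∸ 2 ^ L) (κ ∘ (2 ^ L +_)) ↝⟨ L ⟩ κ a) (m+[n∸m]≡n 2^L≤)
          (sendℕ-↝ p L (λ z → f z ∸ 2 ^ L) (κ ∘ (2 ^ L +_)) rest<2^L))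
    where
    rest<2^L : f (input p x y) ∸ 2 ^ L < 2 ^ L
    rest<2^L = m<n+o⇒m∸n<o _ _ {{m^n≢0 2 L}} (subst (f (input p x y) <_) (cong (2 ^ L +_) (+-identityʳ _)) lt)

  module _ {m : ℕ} where

    announce-nothing : ∀ p L {h κ} → h (input p x y) ≡ nothing → announce {m = m} p L h κ ↝⟨ 1 ⟩ κ nothing
    announce-nothing p L eq = ask-↝ p (cong is-just eq)

    announce-just : ∀ p L {h κ u d} → h (input p x y) ≡ just (u , d) → toℕ u < 2 ^ L → d < 2 ^ L →
                    announce {m = m} p L h κ ↝⟨ suc (L + L) ⟩ κ (just (u , d))
    announce-just p L {h} {κ} {u} {d} eq u<2^L d<2^L =
      subst (λ a → announce p L h κ ↝⟨ suc (L + L) ⟩ κ a) decoded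
        (↝-trans (ask-↝ p (cong is-just eq))
          (↝-trans (sendℕ-↝ p L (λ z → vertexCode (h z))
                              (λ i → sendℕ p L (λ z → numberCode (h z)) (λ d → κ (decode i d)))
                     (subst (λ a → vertexCode a < 2 ^ L) (sym eq) u<2^L))
                   (sendℕ-↝ p L (λ z → numberCode (h z)) (λ d → κ (decode (vertexCode (h (input p x y))) d))
                     (subst (λ a → numberCode a < 2 ^ L) (sym eq) d<2^L))))
      where
      decoded : decode (vertexCode (h (input p x y))) (numberCode (h (input p x y))) ≡ just (u , d)
      decoded = trans (cong (λ a → decode (vertexCode a) (numberCode a)) eq) (decode-toℕ u d)

record Estimate : Set where
  field
    boundᴬ boundᴮ budget : ℕ
open Estimate

bound : Party → Estimate → ℕ
bound Alice = boundᴬ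
bound Bob   = boundᴮ

total : Estimate → ℕ
total e = boundᴬ e + boundᴮ e

setBound : Party → ℕ → Estimate → Estimate
setBound Alice d e = record e { boundᴬ = d }
setBound Bob   d e = record e { boundᴮ = d }

refine : Party → ℕ → Estimate → Estimate
refine p d e = record (setBound p d e) { budget = pred (budget e) }

module DegeneracyProtocol (n k : ℕ) where

  width : ℕ
  width = suc ⌈log₂ n ⌉

  Protocolₙ : Set
  Protocolₙ = Protocol (Graph n) (Graph n) (Out n)

  record State : Set where
    field
      alive     : Subset n
      estimates : Vec Estimate n
      order     : Ordering n
      peeled    : ℕ
  open State public

  estimate : State → Fin n → Estimate
  estimate s = lookup (estimates s)

  Peelable : State → Fin n → Set
  Peelable s v = v ∈ alive s × total (estimate s v) ≤ k

  peelable? : ∀ s v → Dec (Peelable s v)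
  peelable? s v = (v ∈? alive s) ×-dec (total (estimate s v) ≤? k)

  revealed : State → Party → Graph n → Fin n → Estimate
  revealed s p E u = refine p (degIn E (alive s) u) (estimate s u)

  -- p may announce u if u's exact degree at least halves the excess total − k.
  Claimable : State → Party → Graph n → Fin n → Set
  Claimable s p E u = u ∈ alive s × 2 * total (revealed s p E u) ≤ k + total (estimate s u)

  claimable? : ∀ s p E u → Dec (Claimable s p E u)
  claimable? s p E u = (u ∈? alive s) ×-dec (2 * total (revealed s p E u) ≤? k + total (estimate s u))

  data Situation (s : State) : Set where
    finished : Empty (alive s) → Situation s
    peelable : ∀ v → Peelable s v → Situation s
    stuck    : Nonempty (alive s) → (∀ v → ¬ Peelable s v) → Situation s

  situation : ∀ s → Situation s
  situation s with nonempty? (alive s)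
  ... | no  empty    = finished empty
  ... | yes nonempty with any? (peelable? s)
  ...   | yes (v , pv) = peelable v pv
  ...   | no  ¬pv      = stuck nonempty (λ v pv → ¬pv (v , pv))

  claim : State → Party → Graph n → Maybe (Fin n × ℕ)
  claim s p E with any? (claimable? s p E)
  ... | yes (u , _) = just (u , degIn E (alive s) u)
  ... | no  _       = nothing

  data ClaimView (s : State) (p : Party) (E : Graph n) : Maybe (Fin n × ℕ) → Set where
    none : (∀ u → ¬ Claimable s p E u) → ClaimView s p E nothing
    some : ∀ u → Claimable s p E u → ClaimView s p E (just (u , degIn E (alive s) u))

  claim-view : ∀ s p E → ClaimView s p E (claim s p E)
  claim-view s p E with any? (claimable? s p E)
  ... | yes (u , c) = some u c
  ... | no  ¬c      = none (λ u c → ¬c (u , c))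

  -- The slot is position peeled s; mod n only spares the proof that peeled s < n,
  -- which holds whenever v is alive.
  peel : Fin n → State → State
  peel v s = record s
    { alive  = alive s - v
    ; order  = order s ∘ₚ transpose (order s ⟨$⟩ʳ v) (_mod_ (peeled s) n {{nonZeroIndex v}})
    ; peeled = suc (peeled s) }

  revise : Party → Fin n → ℕ → State → State
  revise p u d s = record s { estimates = updateAt (estimates s) u (refine p d) }

  mutual
    peeling : ℕ → State → Protocolₙ
    peeling zero       s = leaf (inj₂ (alive s))
    peeling (suc fuel) s = step fuel s (situation s)

    step : ℕ → (s : State) → Situation s → Protocolₙ
    step fuel s (finished _)   = leaf (inj₁ (order s))
    step fuel s (peelable v _) = peeling fuel (peel v s)
    step fuel s (stuck _ _)    = listen fuel s Alice (listen fuel s Bob (leaf (inj₂ (alive s))))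

    listen : ℕ → State → Party → Protocolₙ → Protocolₙ
    listen fuel s p otherwise = announce p width (claim s p) (respond fuel s p otherwise)

    respond : ℕ → State → Party → Protocolₙ → Maybe (Fin n × ℕ) → Protocolₙ
    respond fuel s p otherwise nothing        = otherwise
    respond fuel s p otherwise (just (u , d)) = peeling fuel (revise p u d s)

  initial : State
  initial = record
    { alive     = ⊤
    ; estimates = replicate n (record { boundᴬ = n ; boundᴮ = n ; budget = suc width })
    ; order     = id
    ; peeled    = 0 }

  potential : State → ℕ
  potential s = sum (map budget (estimates s))

  measure : State → ℕ
  measure s = ∣ alive s ∣ + potential s

  -- The fuel exceeds the measure, which every round decreases, so peeling never runs dry.
  protocol : Protocolₙ
  protocol = peeling (suc (measure initial)) initial

module Analysis (n k : ℕ) (EA EB : Graph n) (disjoint : Disjoint EA EB) where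
  open DegeneracyProtocol n k
  open Execution {O = Out n} EA EB

  G : Graph n
  G = EA ∪ᴳ EB

  graph : Party → Graph n
  graph p = input p EA EB

  record Sound (R : Subset n) (u : Fin n) (e : Estimate) : Set where
    field
      bounds        : ∀ p → degIn (graph p) R u ≤ bound p e
      within-budget : total e < k + 2 ^ budget e
  open Sound

  sound-⊆ : ∀ {R R′ u e} → R′ ⊆ R → Sound R u e → Sound R′ u e
  sound-⊆ R′⊆R snd = record
    { bounds        = λ p → ≤-trans (degIn-mono (graph p) _ R′⊆R) (bounds snd p)
    ; within-budget = within-budget snd }

  degIn≤total : ∀ {R u e} → Sound R u e → degIn G R u ≤ total e
  degIn≤total {R} {u} snd =
    ≤-trans (≤-reflexive (degIn-∪ᴳ {G = EA} {H = EB} disjoint R u))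
            (+-mono-≤ (bounds snd Alice) (bounds snd Bob))

  budget-positive : ∀ {R u e} → Sound R u e → k < total e → 0 < budget e
  budget-positive {e = e} snd k<total with budget e | within-budget snd
  ... | zero  | within = contradiction (m<1+n⇒m≤n (subst (total e <_) (+-comm k 1) within)) (<⇒≱ k<total)
  ... | suc _ | _      = s≤s z≤n

  sound-refine : ∀ {R u e} p → Sound R u e → k < total e →
                 2 * total (refine p (degIn (graph p) R u) e) ≤ k + total e →
                 Sound R u (refine p (degIn (graph p) R u) e)
  sound-refine {R} {u} {e} p snd k<total halving = record
    { bounds        = λ q → refined p q (bounds snd q)
    ; within-budget = halved }
    where
    refined : ∀ p q → degIn (graph q) R u ≤ bound q e →
              degIn (graph q) R u ≤ bound q (refine p (degIn (graph p) R u) e)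
    refined Alice Alice _ = ≤-refl
    refined Alice Bob   b = b
    refined Bob   Alice b = b
    refined Bob   Bob   _ = ≤-refl
    halved : total (refine p (degIn (graph p) R u) e) < k + 2 ^ pred (budget e)
    halved with budget e | within-budget snd | budget-positive snd k<total
    ... | suc b | within | _ = halve-excess b halving within

  record Invariant (s : State) : Set where
    field
      ordered : PeelingOrder G k (alive s) (order s) (peeled s)
      sound   : ∀ {u} → u ∈ alive s → Sound (alive s) u (estimate s u)
      dense⊆  : ContainsDense G (suc k) (alive s)
  open Invariant

  invariant-initial : Invariant initial
  invariant-initial = record
    { ordered = record
      { alive-late   = λ _ → z≤n
      ; peeled-early = λ u∉⊤ → contradiction ∈⊤ u∉⊤
      ; peeled-odeg  = λ u∉⊤ → contradiction ∈⊤ u∉⊤ }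
    ; sound   = λ {u} _ → subst (Sound ⊤ u) (sym (lookup-replicate u _)) (record
      { bounds        = λ { Alice → degIn≤n EA ⊤ u ; Bob → degIn≤n EB ⊤ u }
      ; within-budget = double-below {w = width} k (n<2^suc⌈log₂n⌉ n) })
    ; dense⊆  = λ _ _ → ⊆⊤ }

  module _ {s : State} (inv : Invariant s) where
    private
      R : Subset n
      R = alive s

    invariant-peel : ∀ {v} → Peelable s v → Invariant (peel v s)
    invariant-peel {v} (v∈R , total≤k) = record
      { ordered = peelingOrder-remove (ordered inv) v∈R _ slot≡peeled deg≤k
      ; sound   = λ u∈R′ → sound-⊆ (p─q⊆p R _) (sound inv (p─q⊆p R _ u∈R′))
      ; dense⊆  = containsDense-remove G (dense⊆ inv) deg≤k }
      where
      deg≤k : degIn G R v ≤ k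
      deg≤k = ≤-trans (degIn≤total (sound inv v∈R)) total≤k
      peeled<n : peeled s < n
      peeled<n = ≤-<-trans (PeelingOrder.alive-late (ordered inv) v∈R) (toℕ<n _)
      slot≡peeled : toℕ (_mod_ (peeled s) n {{nonZeroIndex v}}) ≡ peeled s
      slot≡peeled = trans (toℕ-fromℕ< _) (m<n⇒m%n≡m {{nonZeroIndex v}} peeled<n)

    measure-peel : ∀ {v} → v ∈ R → measure (peel v s) < measure s
    measure-peel v∈R = +-monoˡ-< (potential s) (x∈p⇒∣p-x∣<∣p∣ v∈R)

    module _ (¬peelable : ∀ v → ¬ Peelable s v) (p : Party) {u} (c : Claimable s p (graph p) u) where
      private
        d : ℕ
        d = degIn (graph p) R u
        k<total : k < total (estimate s u)
        k<total = ≰⇒> λ total≤k → ¬peelable u (proj₁ c , total≤k)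

      invariant-revise : Invariant (revise p u d s)
      invariant-revise = record
        { ordered = ordered inv
        ; sound   = sound′
        ; dense⊆  = dense⊆ inv }
        where
        sound′ : ∀ {w} → w ∈ R → Sound R w (estimate (revise p u d s) w)
        sound′ {w} w∈R with w ≟ u
        ... | yes refl = subst (Sound R u) (sym (lookup∘updateAt u (estimates s)))
                           (sound-refine p (sound inv (proj₁ c)) k<total (proj₂ c))
        ... | no  w≢u  = subst (Sound R w) (sym (lookup∘updateAt′ w u w≢u (estimates s))) (sound inv w∈R)

      potential-revise : potential (revise p u d s) < potential s
      potential-revise = sum-map-updateAt-< budget (estimates s) u
        (≤-reflexive (suc-pred _ {{>-nonZero (budget-positive (sound inv (proj₁ c)) k<total)}}))

    accept : Empty R → Correct G k (inj₁ (order s))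
    accept empty = degeneracy≤-if-empty G (dense⊆ inv) empty
                 , λ v → PeelingOrder.peeled-odeg (ordered inv) λ v∈R → empty (v , v∈R)

    reject : Nonempty R → (∀ u → ¬ Claimable s Alice EA u) → (∀ u → ¬ Claimable s Bob EB u) →
             Correct G k (inj₂ R)
    reject nonempty passA passB = degeneracy>-if-core G core nonempty , core , nonempty
      where
      dense : MinDegAtLeast G (suc k) R
      dense u u∈R = subst (k <_) (sym (degIn-∪ᴳ {G = EA} {H = EB} disjoint R u))
        (excess-split (boundᴬ e) (boundᴮ e) (degIn EA R u) (degIn EB R u)
          (≰⇒> λ le → passA u (u∈R , le)) (≰⇒> λ le → passB u (u∈R , le)))
        where
        e : Estimate
        e = estimate s u
      core : IsCore G (suc k) R
      core = isCore-if-containsDense G dense (dense⊆ inv)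

  Settles : Protocolₙ → ℕ → Set
  Settles π b = Correct G k (run π EA EB) × bits π EA EB ≤ b

  settles-↝ : ∀ {π ρ c b} → π ↝⟨ c ⟩ ρ → Settles ρ b → Settles π (c + b)
  settles-↝ {c = c} (continues same extra) (correct , bits≤) =
    subst (Correct G k) (sym same) correct , ≤-trans (≤-reflexive extra) (+-monoʳ-≤ c bits≤)

  settles-weaken : ∀ {π b b′} → b ≤ b′ → Settles π b → Settles π b′
  settles-weaken b≤b′ (correct , bits≤) = correct , ≤-trans bits≤ b≤b′

  -- A claim by Bob costs Alice's pass bit and his own announcement.
  unit : ℕ
  unit = suc (suc (width + width))

  mutual
    peeling-settles : ∀ fuel s → Invariant s → measure s < fuel →
                      Settles (peeling fuel s) (unit * potential s + 2)
    peeling-settles (suc fuel) s inv (s≤s μ≤fuel) = step-settles fuel s inv μ≤fuel (situation s)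

    step-settles : ∀ fuel s → Invariant s → measure s ≤ fuel → (σ : Situation s) →
                   Settles (step fuel s σ) (unit * potential s + 2)
    step-settles fuel s inv μ≤fuel (finished empty) = accept inv empty , z≤n
    step-settles fuel s inv μ≤fuel (peelable v pv) =
      peeling-settles fuel (peel v s) (invariant-peel inv pv) (<-≤-trans (measure-peel inv (proj₁ pv)) μ≤fuel)
    step-settles fuel s inv μ≤fuel (stuck nonempty ¬peelable) =
      listen-settles fuel s Alice inv μ≤fuel ¬peelable λ passA →
      listen-settles fuel s Bob   inv μ≤fuel ¬peelable λ passB →
      reject inv nonempty passA passB , z≤n

    listen-settles : ∀ fuel s p {π m} → Invariant s → measure s ≤ fuel → (∀ v → ¬ Peelable s v) →
                     ((∀ u → ¬ Claimable s p (graph p) u) → Settles π (unit * potential s + m)) →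
                     Settles (listen fuel s p π) (unit * potential s + suc m)
    listen-settles fuel s p {π} {m} inv μ≤fuel ¬peelable passing
      with claim s p (graph p) in eq | claim-view s p (graph p)
    ... | nothing | none pass =
      settles-weaken (≤-reflexive (sym (+-suc _ m)))
        (settles-↝ (announce-nothing p width {κ = respond fuel s p π} eq) (passing pass))
    ... | just _  | some u c  =
      settles-weaken (claim-cost (suc (width + width)) m revised<)
        (settles-↝ (announce-just p width {κ = respond fuel s p π} eq (<-trans (toℕ<n u) n<2^width) d<2^width)
          (peeling-settles fuel _ (invariant-revise inv ¬peelable p c)
            (<-≤-trans (+-monoʳ-< ∣ alive s ∣ revised<) μ≤fuel)))
      where
      n<2^width : n < 2 ^ width
      n<2^width = n<2^suc⌈log₂n⌉ n
      d<2^width : degIn (graph p) (alive s) u < 2 ^ width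
      d<2^width = ≤-<-trans (degIn≤n (graph p) (alive s) u) n<2^width
      revised< : potential (revise p u (degIn (graph p) (alive s) u) s) < potential s
      revised< = potential-revise inv ¬peelable p c

  settles : Settles protocol (unit * (n * suc width) + 2)
  settles = subst (λ Φ → Settles protocol (unit * Φ + 2))
    (trans (cong sum (map-replicate budget _ n)) (sum-replicate n (suc width)))
    (peeling-settles _ initial invariant-initial (n<1+n _))

lemma6p2 : Σ ((n k : ℕ) → Protocol (Graph n) (Graph n) (Out n)) λ Π →
    (∀ n k (EA EB : Graph n) → Disjoint EA EB →
       Correct (EA ∪ᴳ EB) k (run (Π n k) EA EB))
    × (∃ λ c → ∃ λ N₀ → ∀ n k (EA EB : Graph n) → N₀ ≤ n → Disjoint EA EB →
         bits (Π n k) EA EB ≤ c * n * ⌈log₂ n ⌉ ^ 2)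
lemma6p2 = DegeneracyProtocol.protocol
         , (λ n k EA EB disjoint → proj₁ (Analysis.settles n k EA EB disjoint))
         , 20 , 2 , λ n k EA EB 2≤n disjoint →
             ≤-trans (proj₂ (Analysis.settles n k EA EB disjoint))
                     (total-cost (≤-trans (s≤s z≤n) 2≤n) (1≤⌈log₂n⌉ 2≤n))
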